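{- Let $\mathcal M=(U,\mathcal I)$ be a matroid with weight function $w:U\to\mathbb R$, let $I,O\subseteq U$ with $I\cap O=\emptyset$, and let $P^\ast,Q^\ast\in\mathcal B^\ast(I,O)$. For any element $y$ of minimum weight in $Q^\ast\setminus P^\ast$, there exists $x\in P^\ast\setminus Q^\ast$ such that $(x,y)$ is an $I,O$-preserving zero-exchange for $P^\ast$. Furthermore, $x$ is an element of minimum weight in $P^\ast\setminus Q^\ast$.
   Context: $w(S)=\sum_{x\in S}w(x)$. $\mathcal B^\ast$ denotes the set of minimum-weight bases, and $\mathcal B^\ast(I,O)=\{B\in\mathcal B^\ast: I\subseteq B,\ B\cap O=\emptyset\}$. For a basis $B$, a pair $(x,y)$ with $x\in B$, $y\notin B$ is an exchange for $B$ if $(B\setminus\{x\})\cup\{y\}$ is a basis; it is a zero-exchange if $w(y)-w(x)=0$. For $B\in\mathcal B^\ast(I,O)$, an exchange $(x,y)$ for $B$ is $I,O$-preserving if $(B\setminus\{x\})\cup\{y\}\in\mathcal B^\ast(I,O)$. -}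

module Defs where

open import Data.Nat using (ℕ; zero; suc; _<_)
open import Data.Bool using (Bool; true; false)
open import Data.Vec using (Vec; []; _∷_)
open import Data.Fin using (Fin) renaming (zero to fzero; suc to fsuc)
open import Data.Fin.Subset using (Subset; _∈_; _∉_; _⊆_; _∩_; _∪_; _─_; _-_; ⁅_⁆; ∣_∣; Empty) renaming (⊥ to ∅)
open import Data.Product using (Σ; ∃; ∃-syntax; _×_; _,_)
open import Relation.Binary.PropositionalEquality using (_≡_)
open import Relation.Binary.Structures using (IsTotalOrder)
open import Algebra.Structures using (IsAbelianGroup)

-- Weights: a totally ordered abelian group (ℝ with + and ≤ is an instance).
record OrderedAbelianGroup : Set₁ where
  field
    Carrier : Set
    _+_ : Carrier → Carrier → Carrier
    0# : Carrier
    neg : Carrier → Carrier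
    _≤_ : Carrier → Carrier → Set
    isAbelianGroup : IsAbelianGroup _≡_ _+_ 0# neg
    isTotalOrder : IsTotalOrder _≡_ _≤_
    +-mono-≤ : ∀ {a b} c → a ≤ b → (a + c) ≤ (b + c)

  _-ᵍ_ : Carrier → Carrier → Carrier
  a -ᵍ b = a + neg b

record Matroid (n : ℕ) : Set₁ where
  field
    Independent : Subset n → Set
    indep-∅ : Independent ∅
    indep-⊆ : ∀ {A B} → A ⊆ B → Independent B → Independent A
    augment : ∀ {A B} → Independent A → Independent B → ∣ A ∣ < ∣ B ∣ →
              ∃[ x ] (x ∈ B × x ∉ A × Independent (A ∪ ⁅ x ⁆))

  IsBasis : Subset n → Set
  IsBasis B = Independent B × (∀ A → Independent A → B ⊆ A → A ⊆ B)

module Weighted (G : OrderedAbelianGroup) where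
  open OrderedAbelianGroup G

  weight : ∀ {n} → (Fin n → Carrier) → Subset n → Carrier
  weight {zero} w [] = 0#
  weight {suc n} w (true ∷ p) = w fzero + weight (λ i → w (fsuc i)) p
  weight {suc n} w (false ∷ p) = weight (λ i → w (fsuc i)) p

  module _ {n : ℕ} (M : Matroid n) (w : Fin n → Carrier) where
    open Matroid M

    IsMinBasis : Subset n → Set
    IsMinBasis B = IsBasis B × (∀ B′ → IsBasis B′ → weight w B ≤ weight w B′)

    IsMinBasisIO : Subset n → Subset n → Subset n → Set
    IsMinBasisIO I O B = IsMinBasis B × I ⊆ B × Empty (B ∩ O)

    swap : Subset n → Fin n → Fin n → Subset n
    swap B x y = (B - x) ∪ ⁅ y ⁆

    IsExchange : Subset n → Fin n → Fin n → Set
    IsExchange B x y = x ∈ B × y ∉ B × IsBasis (swap B x y)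

    IsZeroExchange : Subset n → Fin n → Fin n → Set
    IsZeroExchange B x y = IsExchange B x y × (w y -ᵍ w x) ≡ 0#

    IsIOPreserving : Subset n → Subset n → Subset n → Fin n → Fin n → Set
    IsIOPreserving I O B x y = IsExchange B x y × IsMinBasisIO I O (swap B x y)

    IsMinElem : Fin n → Subset n → Set
    IsMinElem y S = y ∈ S × (∀ z → z ∈ S → w y ≤ w z)

-- Basis exchange by augmentation: extending (P ∩ Q) ∪ {y} inside P ∪ {y} to the rank of P
-- yields a basis P − x + y with x ∈ P ∖ Q. Minimality of P gives w x ≤ w y. Applying the same
-- exchange from Q to any z ∈ P ∖ Q gives some y′ ∈ Q ∖ P with w y ≤ w y′ ≤ w z, so w y is a
-- lower bound on P ∖ Q; hence w x = w y, the swap has the weight of P, and x is minimal in P ∖ Q.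
-- Membership in I and O is preserved because I ⊆ P ∩ Q, x ∉ Q and y ∈ Q.
module Submission where

open import Defs
open import Algebra.Bundles using (AbelianGroup)
import Algebra.Properties.AbelianGroup as AbelianGroupProperties
import Algebra.Properties.Group as GroupProperties
open import Data.Bool using (true; false)
open import Data.Empty using (⊥-elim)
open import Data.Fin using (Fin) renaming (zero to fzero; suc to fsuc)
open import Data.Fin.Properties using (any?)
open import Data.Fin.Subset using (Subset; _∈_; _∉_; _⊆_; _∩_; _∪_; _─_; _-_; ⁅_⁆; ∣_∣; Empty)
open import Data.Fin.Subset.Properties
  using (_∈?_; ∪-identityʳ; p─⊥≡p; x∈⁅x⁆; x∈⁅y⁆⇒x≡y; p⊆p∪q; q⊆p∪q; x∈p∪q⁺; x∈p∪q⁻;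
         p∩q⊆p; p∩q⊆q; x∈p∩q⁺; x∈p∩q⁻; p─q⊆p; x∈p∧x∉q⇒x∈p─q; x∈p∧x≢y⇒x∈p-y; p⊂q⇒∣p∣<∣q∣)
open import Data.Nat using (ℕ; zero; suc; _+_; _∸_; _≤_; _<_; s≤s)
open import Data.Nat.Properties using (+-suc; m≤n+m; m∸n+n≡m; ≮⇒≥; ≤⇒≯; <-irrefl; ≤-reflexive)
open import Data.Product using (∃-syntax; _×_; _,_; proj₁)
open import Data.Sum using (inj₁; inj₂)
open import Data.Vec.Base using (_∷_; here; there)
open import Function using (_∘_)
open import Relation.Nullary using (¬_; yes; no)
open import Relation.Nullary.Decidable using (¬?; _×-dec_; decidable-stable)
open import Relation.Binary.PropositionalEquality
  using (_≡_; refl; sym; trans; cong; subst; subst₂; module ≡-Reasoning)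
open import Relation.Binary.Structures using (IsTotalOrder)

private variable
  n : ℕ
  p q r : Subset n
  x y : Fin n

x∈p─q⇒x∉q : ∀ (p q : Subset n) → x ∈ p ─ q → x ∉ q
x∈p─q⇒x∉q (s ∷ p) (t ∷ q) (there x∈p─q) (there x∈q) = x∈p─q⇒x∉q p q x∈p─q x∈q
x∈p─q⇒x∉q (true ∷ p) (true ∷ q) () here
x∈p─q⇒x∉q (false ∷ p) (true ∷ q) () here

x∉p⇒∣p∪⁅x⁆∣≡suc∣p∣ : ∀ (p : Subset n) → x ∉ p → ∣ p ∪ ⁅ x ⁆ ∣ ≡ suc ∣ p ∣
x∉p⇒∣p∪⁅x⁆∣≡suc∣p∣ {x = fzero}   (true  ∷ p) x∉p = ⊥-elim (x∉p here)
x∉p⇒∣p∪⁅x⁆∣≡suc∣p∣ {x = fzero}   (false ∷ p) x∉p = cong (suc ∘ ∣_∣) (∪-identityʳ p)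
x∉p⇒∣p∪⁅x⁆∣≡suc∣p∣ {x = fsuc x} (true  ∷ p) x∉p = cong suc (x∉p⇒∣p∪⁅x⁆∣≡suc∣p∣ p (x∉p ∘ there))
x∉p⇒∣p∪⁅x⁆∣≡suc∣p∣ {x = fsuc x} (false ∷ p) x∉p = x∉p⇒∣p∪⁅x⁆∣≡suc∣p∣ p (x∉p ∘ there)

x∈p⇒suc∣p-x∣≡∣p∣ : ∀ (p : Subset n) → x ∈ p → suc ∣ p - x ∣ ≡ ∣ p ∣
x∈p⇒suc∣p-x∣≡∣p∣ (true  ∷ p) here          = cong (suc ∘ ∣_∣) (p─⊥≡p p)
x∈p⇒suc∣p-x∣≡∣p∣ (true  ∷ p) (there x∈p) = cong suc (x∈p⇒suc∣p-x∣≡∣p∣ p x∈p)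
x∈p⇒suc∣p-x∣≡∣p∣ (false ∷ p) (there x∈p) = x∈p⇒suc∣p-x∣≡∣p∣ p x∈p

∣[p-x]∪⁅y⁆∣≡∣p∣ : ∀ (p : Subset n) → x ∈ p → y ∉ p → ∣ (p - x) ∪ ⁅ y ⁆ ∣ ≡ ∣ p ∣
∣[p-x]∪⁅y⁆∣≡∣p∣ {x = x} p x∈p y∉p =
  trans (x∉p⇒∣p∪⁅x⁆∣≡suc∣p∣ (p - x) (y∉p ∘ p─q⊆p p ⁅ x ⁆)) (x∈p⇒suc∣p-x∣≡∣p∣ p x∈p)

p⊆q∧∣q∣≤∣p∣⇒q⊆p : p ⊆ q → ∣ q ∣ ≤ ∣ p ∣ → q ⊆ p
p⊆q∧∣q∣≤∣p∣⇒q⊆p {p = p} p⊆q ∣q∣≤∣p∣ {x} x∈q = decidable-stable (x ∈? p) λ x∉p →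
  ≤⇒≯ ∣q∣≤∣p∣ (p⊂q⇒∣p∣<∣q∣ (p⊆q , x , x∈q , x∉p))

⊈-witness : ¬ p ⊆ q → ∃[ x ] (x ∈ p × x ∉ q)
⊈-witness {p = p} {q} p⊈q with any? (λ x → x ∈? p ×-dec ¬? (x ∈? q))
... | yes witness = witness
... | no ¬witness = ⊥-elim (p⊈q λ {x} x∈p →
  decidable-stable (x ∈? q) λ x∉q → ¬witness (x , x∈p , x∉q))

∪⁅x⁆-least : p ⊆ r → x ∈ r → p ∪ ⁅ x ⁆ ⊆ r
∪⁅x⁆-least {p = p} {r = r} {x = x} p⊆r x∈r z∈p∪x with x∈p∪q⁻ p ⁅ x ⁆ z∈p∪x
... | inj₁ z∈p = p⊆r z∈p
... | inj₂ z∈⁅x⁆ = subst (_∈ r) (sym (x∈⁅y⁆⇒x≡y x z∈⁅x⁆)) x∈r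

⊆-swap : q ⊆ p ∪ ⁅ y ⁆ → x ∉ q → q ⊆ (p - x) ∪ ⁅ y ⁆
⊆-swap {p = p} {y = y} q⊆p∪y x∉q z∈q with x∈p∪q⁻ p ⁅ y ⁆ (q⊆p∪y z∈q)
... | inj₁ z∈p = x∈p∪q⁺ (inj₁ (x∈p∧x≢y⇒x∈p-y z∈p λ { refl → x∉q z∈q }))
... | inj₂ z∈⁅y⁆ = x∈p∪q⁺ (inj₂ z∈⁅y⁆)

swap-disjoint : Empty (p ∩ r) → y ∉ r → Empty (((p - x) ∪ ⁅ y ⁆) ∩ r)
swap-disjoint {p = p} {r = r} {y = y} {x = x} p∩r=∅ y∉r (z , z∈swap∩r)
  with x∈p∩q⁻ ((p - x) ∪ ⁅ y ⁆) r z∈swap∩r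
... | z∈swap , z∈r with x∈p∪q⁻ (p - x) ⁅ y ⁆ z∈swap
...   | inj₁ z∈p-x = p∩r=∅ (z , x∈p∩q⁺ (p─q⊆p p ⁅ x ⁆ z∈p-x , z∈r))
...   | inj₂ z∈⁅y⁆ = y∉r (subst (_∈ r) (x∈⁅y⁆⇒x≡y y z∈⁅y⁆) z∈r)

module OrderedAbelianGroupProperties (G : OrderedAbelianGroup) where
  open OrderedAbelianGroup G renaming (_+_ to infixl 6 _+ᵍ_; _≤_ to infix 4 _≤ᵍ_)
  open Weighted G using (weight)

  abelianGroup : AbelianGroup _ _
  abelianGroup = record { isAbelianGroup = isAbelianGroup }

  open AbelianGroup abelianGroup using (assoc; comm; group)
  open AbelianGroupProperties abelianGroup using (xyx⁻¹≈y)
  open GroupProperties group public using (∙-cancelʳ; x≈y⇒x∙y⁻¹≈ε)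

  +-cancelˡ-≤ : ∀ c {a b} → c +ᵍ a ≤ᵍ c +ᵍ b → a ≤ᵍ b
  +-cancelˡ-≤ c {a} {b} = subst₂ _≤ᵍ_ (xyx⁻¹≈y c a) (xyx⁻¹≈y c b) ∘ +-mono-≤ (neg c)

  weight-insert : (w : Fin n → Carrier) (p : Subset n) → x ∉ p → weight w (p ∪ ⁅ x ⁆) ≡ weight w p +ᵍ w x
  weight-insert {x = fzero}   w (true  ∷ p) x∉p = ⊥-elim (x∉p here)
  weight-insert {x = fzero}   w (false ∷ p) x∉p =
    trans (cong (λ q → w fzero +ᵍ weight (w ∘ fsuc) q) (∪-identityʳ p)) (comm _ _)
  weight-insert {x = fsuc x} w (true  ∷ p) x∉p =
    trans (cong (w fzero +ᵍ_) (weight-insert (w ∘ fsuc) p (x∉p ∘ there))) (sym (assoc _ _ _))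
  weight-insert {x = fsuc x} w (false ∷ p) x∉p = weight-insert (w ∘ fsuc) p (x∉p ∘ there)

  weight-remove : (w : Fin n → Carrier) (p : Subset n) → x ∈ p → weight w (p - x) +ᵍ w x ≡ weight w p
  weight-remove w (true  ∷ p) here =
    trans (cong (λ q → weight (w ∘ fsuc) q +ᵍ w fzero) (p─⊥≡p p)) (comm _ _)
  weight-remove w (true  ∷ p) (there x∈p) =
    trans (assoc _ _ _) (cong (w fzero +ᵍ_) (weight-remove (w ∘ fsuc) p x∈p))
  weight-remove w (false ∷ p) (there x∈p) = weight-remove (w ∘ fsuc) p x∈p

  weight-swap : (w : Fin n → Carrier) (p : Subset n) → x ∈ p → y ∉ p →
                weight w ((p - x) ∪ ⁅ y ⁆) +ᵍ w x ≡ weight w p +ᵍ w y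
  weight-swap {x = x} {y = y} w p x∈p y∉p = begin
    weight w ((p - x) ∪ ⁅ y ⁆) +ᵍ w x  ≡⟨ cong (_+ᵍ w x) (weight-insert w (p - x) (y∉p ∘ p─q⊆p p ⁅ x ⁆)) ⟩
    weight w (p - x) +ᵍ w y +ᵍ w x     ≡⟨ assoc _ _ _ ⟩
    weight w (p - x) +ᵍ (w y +ᵍ w x)   ≡⟨ cong (weight w (p - x) +ᵍ_) (comm (w y) (w x)) ⟩
    weight w (p - x) +ᵍ (w x +ᵍ w y)   ≡⟨ sym (assoc _ _ _) ⟩
    weight w (p - x) +ᵍ w x +ᵍ w y     ≡⟨ cong (_+ᵍ w y) (weight-remove w p x∈p) ⟩
    weight w p +ᵍ w y                  ∎
    where open ≡-Reasoning

module MatroidProperties (M : Matroid n) where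
  open Matroid M

  ∣indep∣≤∣basis∣ : ∀ {A B} → IsBasis B → Independent A → ∣ A ∣ ≤ ∣ B ∣
  ∣indep∣≤∣basis∣ {B = B} (indB , B-max) indA = ≮⇒≥ λ ∣B∣<∣A∣ →
    let z , _ , z∉B , indB∪z = augment indB indA ∣B∣<∣A∣
    in z∉B (B-max (B ∪ ⁅ z ⁆) indB∪z (p⊆p∪q ⁅ z ⁆) (q⊆p∪q B ⁅ z ⁆ (x∈⁅x⁆ z)))

  indep∧∣∣≡∣basis∣⇒basis : ∀ {A B} → IsBasis B → Independent A → ∣ A ∣ ≡ ∣ B ∣ → IsBasis A
  indep∧∣∣≡∣basis∣⇒basis bB indA ∣A∣≡∣B∣ = indA , λ A′ indA′ A⊆A′ →
    p⊆q∧∣q∣≤∣p∣⇒q⊆p A⊆A′ (subst (∣ A′ ∣ ≤_) (sym ∣A∣≡∣B∣) (∣indep∣≤∣basis∣ bB indA′))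

  extend-within : ∀ {A B S} → Independent A → Independent B → A ⊆ S → B ⊆ S → ∣ A ∣ ≤ ∣ B ∣ →
                  ∃[ C ] (Independent C × A ⊆ C × C ⊆ S × ∣ C ∣ ≡ ∣ B ∣)
  extend-within {A} {B} {S} indA indB A⊆S B⊆S ∣A∣≤∣B∣ =
    extend (∣ B ∣ ∸ ∣ A ∣) indA A⊆S (m∸n+n≡m ∣A∣≤∣B∣)
    where
    extend : ∀ {A′} k → Independent A′ → A′ ⊆ S → k + ∣ A′ ∣ ≡ ∣ B ∣ →
             ∃[ C ] (Independent C × A′ ⊆ C × C ⊆ S × ∣ C ∣ ≡ ∣ B ∣)
    extend zero indA′ A′⊆S ∣A′∣≡∣B∣ = _ , indA′ , (λ z∈A′ → z∈A′) , A′⊆S , ∣A′∣≡∣B∣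
    extend {A′} (suc k) indA′ A′⊆S k+1+∣A′∣≡∣B∣ =
      let z , z∈B , z∉A′ , indA′∪z =
            augment indA′ indB (subst (∣ A′ ∣ <_) k+1+∣A′∣≡∣B∣ (s≤s (m≤n+m ∣ A′ ∣ k)))
          k+∣A′∪z∣≡∣B∣ = trans (cong (k +_) (x∉p⇒∣p∪⁅x⁆∣≡suc∣p∣ A′ z∉A′))
                               (trans (+-suc k ∣ A′ ∣) k+1+∣A′∣≡∣B∣)
          C , indC , A′∪z⊆C , C⊆S , ∣C∣≡∣B∣ =
            extend k indA′∪z (∪⁅x⁆-least A′⊆S (B⊆S z∈B)) k+∣A′∪z∣≡∣B∣
      in C , indC , (λ z∈A′ → A′∪z⊆C (p⊆p∪q ⁅ z ⁆ z∈A′)) , C⊆S , ∣C∣≡∣B∣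

  full-indep⊆basis∪⁅y⁆⇒swap : ∀ {P C y} → IsBasis P → y ∉ P → Independent C → y ∈ C →
                               C ⊆ P ∪ ⁅ y ⁆ → ∣ C ∣ ≡ ∣ P ∣ →
                               ∃[ x ] (x ∈ P × x ∉ C × IsBasis ((P - x) ∪ ⁅ y ⁆))
  full-indep⊆basis∪⁅y⁆⇒swap {P} {C} {y} bP y∉P indC y∈C C⊆P∪y ∣C∣≡∣P∣ with ⊈-witness P⊈C
    where
    P⊈C : ¬ P ⊆ C
    P⊈C P⊆C = <-irrefl (sym ∣C∣≡∣P∣) (p⊂q⇒∣p∣<∣q∣ (P⊆C , y , y∈C , y∉P))
  ... | x , x∈P , x∉C = x , x∈P , x∉C , indep∧∣∣≡∣basis∣⇒basis bP (indep-⊆ swap⊆C indC) ∣swap∣≡∣P∣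
    where
    ∣swap∣≡∣P∣ : ∣ (P - x) ∪ ⁅ y ⁆ ∣ ≡ ∣ P ∣
    ∣swap∣≡∣P∣ = ∣[p-x]∪⁅y⁆∣≡∣p∣ P x∈P y∉P
    swap⊆C : (P - x) ∪ ⁅ y ⁆ ⊆ C
    swap⊆C = p⊆q∧∣q∣≤∣p∣⇒q⊆p (⊆-swap C⊆P∪y x∉C) (≤-reflexive (trans ∣swap∣≡∣P∣ (sym ∣C∣≡∣P∣)))

  basis-exchange : ∀ {P Q y} → IsBasis P → IsBasis Q → y ∈ Q ─ P →
                   ∃[ x ] (x ∈ P ─ Q × IsBasis ((P - x) ∪ ⁅ y ⁆))
  basis-exchange {P} {Q} {y} bP@(indP , _) (indQ , _) y∈Q─P =
    let C , indC , A⊆C , C⊆P∪y , ∣C∣≡∣P∣ =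
          extend-within indA indP A⊆P∪y (p⊆p∪q ⁅ y ⁆) (∣indep∣≤∣basis∣ bP indA)
        x , x∈P , x∉C , bSwap =
          full-indep⊆basis∪⁅y⁆⇒swap bP (x∈p─q⇒x∉q Q P y∈Q─P) indC (A⊆C y∈A) C⊆P∪y ∣C∣≡∣P∣
        x∉Q = λ x∈Q → x∉C (A⊆C (p⊆p∪q ⁅ y ⁆ (x∈p∩q⁺ (x∈P , x∈Q))))
    in x , x∈p∧x∉q⇒x∈p─q x∈P x∉Q , bSwap
    where
    A : Subset _
    A = (P ∩ Q) ∪ ⁅ y ⁆
    y∈A : y ∈ A
    y∈A = q⊆p∪q (P ∩ Q) ⁅ y ⁆ (x∈⁅x⁆ y)
    indA : Independent A
    indA = indep-⊆ (∪⁅x⁆-least (p∩q⊆q P Q) (p─q⊆p Q P y∈Q─P)) indQ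
    A⊆P∪y : A ⊆ P ∪ ⁅ y ⁆
    A⊆P∪y = ∪⁅x⁆-least (p⊆p∪q ⁅ y ⁆ ∘ p∩q⊆p P Q) (q⊆p∪q P ⁅ y ⁆ (x∈⁅x⁆ y))

module MinimumBasisProperties (G : OrderedAbelianGroup) (M : Matroid n)
                              (w : Fin n → OrderedAbelianGroup.Carrier G) where
  open OrderedAbelianGroup G renaming (_+_ to infixl 6 _+ᵍ_; _≤_ to infix 4 _≤ᵍ_)
  open IsTotalOrder isTotalOrder using (antisym) renaming (trans to ≤ᵍ-trans)
  open OrderedAbelianGroupProperties G
  open Weighted G
  open Matroid M using (IsBasis)
  open MatroidProperties M

  minBasis-exchange-≤ : ∀ {P x y} → IsMinBasis M w P → x ∈ P → y ∉ P →
                        IsBasis (swap M w P x y) → w x ≤ᵍ w y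
  minBasis-exchange-≤ {P} {x} (_ , P-min) x∈P y∉P bSwap = +-cancelˡ-≤ (weight w P)
    (subst (weight w P +ᵍ w x ≤ᵍ_) (weight-swap w P x∈P y∉P) (+-mono-≤ (w x) (P-min _ bSwap)))

  swap-minBasis : ∀ {P x y} → IsMinBasis M w P → x ∈ P → y ∉ P → IsBasis (swap M w P x y) →
                  w x ≡ w y → IsMinBasis M w (swap M w P x y)
  swap-minBasis {P} {x} (_ , P-min) x∈P y∉P bSwap wx≡wy =
    bSwap , λ B bB → subst (_≤ᵍ weight w B) (sym weight[swap]≡weight[P]) (P-min B bB)
    where
    weight[swap]≡weight[P] = ∙-cancelʳ (w x) _ _
      (trans (weight-swap w P x∈P y∉P) (cong (weight w P +ᵍ_) (sym wx≡wy)))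

  minElem[Q─P]≤P─Q : ∀ {P Q y} → IsBasis P → IsMinBasis M w Q → IsMinElem M w y (Q ─ P) →
                     ∀ z → z ∈ P ─ Q → w y ≤ᵍ w z
  minElem[Q─P]≤P─Q {P} {Q} bP Q*@(bQ , _) (_ , y-min) z z∈P─Q =
    let y′ , y′∈Q─P , bSwap = basis-exchange bQ bP z∈P─Q
    in ≤ᵍ-trans (y-min y′ y′∈Q─P)
                (minBasis-exchange-≤ Q* (p─q⊆p Q P y′∈Q─P) (x∈p─q⇒x∉q P Q z∈P─Q) bSwap)

  minElem-exchange-≡ : ∀ {P Q x y} → IsMinBasis M w P → IsMinBasis M w Q → IsMinElem M w y (Q ─ P) →
                       x ∈ P ─ Q → IsBasis (swap M w P x y) → w x ≡ w y
  minElem-exchange-≡ {P} {Q} P*@(bP , _) Q* y-min@(y∈Q─P , _) x∈P─Q bSwap = antisym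
    (minBasis-exchange-≤ P* (p─q⊆p P Q x∈P─Q) (x∈p─q⇒x∉q Q P y∈Q─P) bSwap)
    (minElem[Q─P]≤P─Q bP Q* y-min _ x∈P─Q)

  exchange-partner-minElem : ∀ {P Q x y} → IsMinBasis M w P → IsMinBasis M w Q →
                             IsMinElem M w y (Q ─ P) → x ∈ P ─ Q → IsBasis (swap M w P x y) →
                             IsMinElem M w x (P ─ Q)
  exchange-partner-minElem P*@(bP , _) Q* y-min x∈P─Q bSwap = x∈P─Q , λ z z∈P─Q →
    subst (_≤ᵍ w z) (sym (minElem-exchange-≡ P* Q* y-min x∈P─Q bSwap))
          (minElem[Q─P]≤P─Q bP Q* y-min z z∈P─Q)

  swap-minBasisIO : ∀ {I O P Q x y} → IsMinBasisIO M w I O P → IsMinBasisIO M w I O Q →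
                    x ∉ Q → y ∈ Q → IsMinBasis M w (swap M w P x y) →
                    IsMinBasisIO M w I O (swap M w P x y)
  swap-minBasisIO {y = y} (_ , I⊆P , P∩O=∅) (_ , I⊆Q , Q∩O=∅) x∉Q y∈Q swap* =
    swap* , ⊆-swap (p⊆p∪q ⁅ y ⁆ ∘ I⊆P) (x∉Q ∘ I⊆Q) ,
    swap-disjoint P∩O=∅ (λ y∈O → Q∩O=∅ (y , x∈p∩q⁺ (y∈Q , y∈O)))

lemma2 : (G : OrderedAbelianGroup) {n : ℕ} (M : Matroid n)
         (w : Fin n → OrderedAbelianGroup.Carrier G) (I O P Q : Subset n) →
         Empty (I ∩ O) →
         Weighted.IsMinBasisIO G M w I O P → Weighted.IsMinBasisIO G M w I O Q →
         (y : Fin n) → Weighted.IsMinElem G M w y (Q ─ P) →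
         ∃[ x ] (x ∈ (P ─ Q) × Weighted.IsZeroExchange G M w P x y
                 × Weighted.IsIOPreserving G M w I O P x y
                 × Weighted.IsMinElem G M w x (P ─ Q))
lemma2 G M w I O P Q _ P*IO@(P* , _) Q*IO@(Q* , _) y y-min@(y∈Q─P , _) =
  let x , x∈P─Q , bSwap = basis-exchange (proj₁ P*) (proj₁ Q*) y∈Q─P
      x∈P = p─q⊆p P Q x∈P─Q
      y∉P = x∈p─q⇒x∉q Q P y∈Q─P
      wx≡wy = minElem-exchange-≡ P* Q* y-min x∈P─Q bSwap
      exchange = x∈P , y∉P , bSwap
      swap*IO = swap-minBasisIO P*IO Q*IO (x∈p─q⇒x∉q P Q x∈P─Q) (p─q⊆p Q P y∈Q─P)
                                (swap-minBasis P* x∈P y∉P bSwap wx≡wy)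
  in x , x∈P─Q , (exchange , x≈y⇒x∙y⁻¹≈ε (sym wx≡wy)) , (exchange , swap*IO) ,
     exchange-partner-minElem P* Q* y-min x∈P─Q bSwap
  where
  open MatroidProperties M using (basis-exchange)
  open MinimumBasisProperties G M w
  open OrderedAbelianGroupProperties G using (x≈y⇒x∙y⁻¹≈ε)
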